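{- Let $G$ be a graph of order $n$ whose edges are coloured with three colours, and suppose that $G$ has no monochromatic component of order at least $\frac n2$. If, for each of two of the colours, there are $4$ components of that colour each of order exactly $\frac n4$, then $\delta(G)<\frac56n$.
   Context: $\delta(G)$ denotes the minimum degree of $G$. For an edge-colouring of $G$, a monochromatic component of a given colour is a connected component of the graph formed by the edges of that colour (on the vertices incident with such edges); its order is its number of vertices. -}

module Defs where

open import Data.Nat using (ℕ; zero; suc; _⊓_)
open import Data.Fin using (Fin; zero; suc)
open import Data.Fin.Subset using (Subset; _∈_; ∣_∣)
open import Data.Maybe using (Maybe; just; nothing; is-just)
open import Data.Vec using (tabulate)
open import Data.Product using (Σ; ∃; _×_)
open import Relation.Binary.PropositionalEquality using (_≡_)
open import Relation.Binary.Construct.Closure.ReflexiveTransitive using (Star)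
open import Relation.Nullary using (¬_)
open import Function.Bundles using (_⇔_)

-- A finite simple graph on vertex set Fin n together with a 3-edge-colouring,
-- encoded as a symmetric, irreflexive function:
-- col u v ≡ nothing  means uv is not an edge,
-- col u v ≡ just k   means uv is an edge of colour k.
record Coloured3Graph (n : ℕ) : Set where
  field
    col   : Fin n → Fin n → Maybe (Fin 3)
    sym   : ∀ u v → col u v ≡ col v u
    irrefl : ∀ v → col v v ≡ nothing
open Coloured3Graph public

module _ {n : ℕ} (G : Coloured3Graph n) where

  nbhd : Fin n → Subset n
  nbhd v = tabulate (λ u → is-just (col G v u))

  deg : Fin n → ℕ
  deg v = ∣ nbhd v ∣

  Adj : Fin 3 → Fin n → Fin n → Set
  Adj k u v = col G u v ≡ just k

  Incident : Fin 3 → Fin n → Set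
  Incident k v = ∃ λ u → Adj k v u

  Component : Fin 3 → Subset n → Set
  Component k S = Σ (Fin n) λ v → Incident k v ×
                    (∀ u → (u ∈ S) ⇔ Star (Adj k) v u)

-- minimum of a function over Fin n (0 for the empty vertex set)
minOver : (n : ℕ) → (Fin n → ℕ) → ℕ
minOver zero f = 0
minOver (suc zero) f = f zero
minOver (suc (suc m)) f = f zero ⊓ minOver (suc m) (λ i → f (suc i))

δ : {n : ℕ} → Coloured3Graph n → ℕ
δ {n} G = minOver n (deg G)

module Submission where

open import Defs hiding (sym)
open import Data.Nat using (ℕ; zero; suc; _+_; _*_; _≤_; _<_; z≤n; s≤s; z<s; >-nonZero)
open import Data.Nat.Properties
open import Data.Nat.GeneralisedArithmetic using (fold)
open import Data.Nat.Tactic.RingSolver using (solve-∀)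
open import Data.Bool using (true; false; if_then_else_)
open import Data.Fin using (Fin; zero; suc)
import Data.Fin as Fin
open import Data.Fin.Patterns using (0F; 1F; 2F)
open import Data.Fin.Properties using (any?) renaming (suc-injective to Fin-suc-injective)
open import Data.Fin.Subset
  using (Subset; _∈_; _∉_; _⊆_; _⊂_; _∪_; _∩_; ∣_∣; ⁅_⁆; ⊥; ⊤; inside; outside)
open import Data.Fin.Subset.Properties
  using ( _∈?_; _⊂?_; ∉⊥; ∈⊤; ∣⊥∣≡0; ∣p∣≤n; ∣p∣≡n⇒p≡⊤; x∈⁅x⁆; x∈⁅y⁆⇒x≡y
        ; ∣⁅x⁆∣≡1; ⊆-antisym; p⊆q⇒∣p∣≤∣q∣; p⊂q⇒∣p∣<∣q∣; p∩q⊆p; p∩q⊆q; x∈p∩q⁺; x∈p∩q⁻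
        ; p⊆p∪q; q⊆p∪q; x∈p∪q⁻; x∈p∪q⁺ )
open import Data.Maybe using (just; nothing; is-just)
open import Data.Maybe.Properties using (≡-dec)
open import Data.Vec using ([]; _∷_; lookup; tabulate)
open import Data.Vec.Properties using (lookup∘tabulate; []=⇒lookup; lookup⇒[]=)
open import Data.Product using (Σ; ∃; _×_; _,_; proj₁; proj₂)
open import Data.Sum using (_⊎_; inj₁; inj₂)
open import Function.Base using (_∘_)
open import Function.Bundles using (_⇔_; mk⇔; Equivalence)
open import Function.Definitions using (Injective)
open import Relation.Binary.PropositionalEquality
open import Relation.Nullary using (¬_; Dec; yes; no; does; contradiction; _×-dec_)
open import Relation.Binary.Construct.Closure.ReflexiveTransitive using (Star; ε; _◅_; _◅◅_; reverse)
open import Relation.Nullary.Decidable using (dec-true)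
open import Algebra.Properties.Semiring.Sum +-*-semiring
  using (sum; sum-syntax; sum-cong-≗; ∑-distrib-+; ∑-comm; *-distribˡ-sum; *-distribʳ-sum)

open Equivalence using (to; from)

-- Proof idea (n = 4a). The k₁-components A₁,…,A₄ are pairwise disjoint of total
-- order n, so they partition the vertices; likewise the k₂-components B₁,…,B₄.
-- Let R be the component of the third colour k₃ containing some vertex v (or {v}),
-- so 2∣R∣ ≤ n. Every neighbour of u ∈ R lies in u's A-class, in u's B-class or in
-- R, which by inclusion–exclusion gives
--   deg u + 1 + ∣A(u) ∩ R∣ + ∣B(u) ∩ R∣ ≤ 2a + ∣R∣.
-- Summing over u ∈ R and double counting turns the middle terms into ∑ᵢ ∣Aᵢ ∩ R∣²
-- and ∑ᵢ ∣Bᵢ ∩ R∣², each at least ∣R∣²/4 by Cauchy–Schwarz; hence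
-- 2(δ + 1) ≤ 4a + ∣R∣ ≤ 6a, i.e. 6δ < 5n.

∑-mono-≤ : ∀ {m} {f g : Fin m → ℕ} → (∀ i → f i ≤ g i) → sum f ≤ sum g
∑-mono-≤ {zero}  f≤g = z≤n
∑-mono-≤ {suc m} f≤g = +-mono-≤ (f≤g zero) (∑-mono-≤ (f≤g ∘ suc))

∑-const : ∀ m x → ∑[ i < m ] x ≡ m * x
∑-const zero    x = refl
∑-const (suc m) x = cong (x +_) (∑-const m x)

2xy≤x²+y²-ordered : ∀ {x y} → x ≤ y → 2 * (x * y) ≤ x * x + y * y
2xy≤x²+y²-ordered {x} x≤y with d , refl ← m≤n⇒∃[o]m+o≡n x≤y = begin
  2 * (x * (x + d))                 ≤⟨ m≤m+n _ (d * d) ⟩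
  2 * (x * (x + d)) + d * d         ≡⟨ square-gap x d ⟩
  x * x + (x + d) * (x + d)         ∎
  where
  open ≤-Reasoning
  square-gap : ∀ x d → 2 * (x * (x + d)) + d * d ≡ x * x + (x + d) * (x + d)
  square-gap = solve-∀

2xy≤x²+y² : ∀ x y → 2 * (x * y) ≤ x * x + y * y
2xy≤x²+y² x y with ≤-total x y
... | inj₁ x≤y = 2xy≤x²+y²-ordered x≤y
... | inj₂ y≤x = subst₂ _≤_ (cong (2 *_) (*-comm y x)) (+-comm (y * y) (x * x))
                        (2xy≤x²+y²-ordered y≤x)

-- Cauchy–Schwarz for m natural numbers: (∑ cᵢ)² ≤ m · ∑ cᵢ².
-- Expand (∑ c)² as a double sum and bound each 2cᵢcⱼ by cᵢ² + cⱼ².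
cauchy-schwarz : ∀ {m} (c : Fin m → ℕ) → sum c * sum c ≤ m * ∑[ i < m ] (c i * c i)
cauchy-schwarz {m} c = *-cancelˡ-≤ 2 (begin
  2 * (sum c * sum c)                                   ≡⟨ cong (2 *_) square-as-double-sum ⟩
  2 * ∑[ i < m ] ∑[ j < m ] (c i * c j)                 ≡⟨ double-distrib ⟩
  ∑[ i < m ] ∑[ j < m ] (2 * (c i * c j))               ≤⟨ ∑-mono-≤ (λ i → ∑-mono-≤ (λ j → 2xy≤x²+y² (c i) (c j))) ⟩
  ∑[ i < m ] ∑[ j < m ] (c i * c i + c j * c j)         ≡⟨ sum-cong-≗ (λ i → ∑-distrib-+ (λ _ → c i * c i) (λ j → c j * c j)) ⟩
  ∑[ i < m ] (∑[ j < m ] (c i * c i) + Q)               ≡⟨ ∑-distrib-+ (λ i → ∑[ j < m ] (c i * c i)) (λ _ → Q) ⟩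
  ∑[ i < m ] ∑[ j < m ] (c i * c i) + ∑[ i < m ] Q      ≡⟨ cong₂ _+_ (sum-cong-≗ (λ i → ∑-const m (c i * c i))) (∑-const m Q) ⟩
  ∑[ i < m ] (m * (c i * c i)) + m * Q                  ≡⟨ cong (_+ m * Q) (sym (*-distribˡ-sum m (λ i → c i * c i))) ⟩
  m * Q + m * Q                                         ≡⟨ cong (m * Q +_) (sym (+-identityʳ (m * Q))) ⟩
  2 * (m * Q)                                           ∎)
  where
  open ≤-Reasoning
  Q : ℕ
  Q = ∑[ i < m ] (c i * c i)
  square-as-double-sum : sum c * sum c ≡ ∑[ i < m ] ∑[ j < m ] (c i * c j)
  square-as-double-sum = trans (*-distribʳ-sum (sum c) c)
                               (sum-cong-≗ (λ i → *-distribˡ-sum (c i) c))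
  double-distrib : 2 * ∑[ i < m ] ∑[ j < m ] (c i * c j) ≡ ∑[ i < m ] ∑[ j < m ] (2 * (c i * c j))
  double-distrib = trans (*-distribˡ-sum 2 (λ i → ∑[ j < m ] (c i * c j))) (sum-cong-≗ (λ i → *-distribˡ-sum 2 (λ j → c i * c j)))

χ : ∀ {n} → Subset n → Fin n → ℕ
χ p u = if lookup p u then 1 else 0

∣∣-as-sum : ∀ {n} (p : Subset n) → ∣ p ∣ ≡ ∑[ u < n ] χ p u
∣∣-as-sum []            = refl
∣∣-as-sum (inside  ∷ p) = cong suc (∣∣-as-sum p)
∣∣-as-sum (outside ∷ p) = ∣∣-as-sum p

∣∩∣-as-sum : ∀ {n} (p q : Subset n) → ∣ p ∩ q ∣ ≡ ∑[ u < n ] (χ p u * χ q u)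
∣∩∣-as-sum []            []            = refl
∣∩∣-as-sum (inside  ∷ p) (inside  ∷ q) = cong suc (∣∩∣-as-sum p q)
∣∩∣-as-sum (inside  ∷ p) (outside ∷ q) = ∣∩∣-as-sum p q
∣∩∣-as-sum (outside ∷ p) (_       ∷ q) = ∣∩∣-as-sum p q

χ-cong : ∀ {m n} {p : Subset m} {q : Subset n} {x y} → (x ∈ p ⇔ y ∈ q) → χ p x ≡ χ q y
χ-cong {p = p} {q} {x} {y} x∈p⇔y∈q with lookup p x in px | lookup q y in qy
... | true  | true  = refl
... | false | false = refl
... | true  | false = contradiction (trans (sym ([]=⇒lookup (to x∈p⇔y∈q (lookup⇒[]= x p px)))) qy) λ ()
... | false | true  = contradiction (trans (sym ([]=⇒lookup (from x∈p⇔y∈q (lookup⇒[]= y q qy)))) px) λ ()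

∑-singleton : ∀ {m} (j : Fin m) (g : Fin m → ℕ) → ∑[ i < m ] (χ ⁅ j ⁆ i * g i) ≡ g j
∑-singleton zero    g = trans (cong (g zero + 0 +_) (∑-⊥ (g ∘ suc))) (trans (+-identityʳ _) (+-identityʳ _))
  where
  ∑-⊥ : ∀ {m} (g : Fin m → ℕ) → ∑[ i < m ] (χ ⊥ i * g i) ≡ 0
  ∑-⊥ {zero}  g = refl
  ∑-⊥ {suc m} g = ∑-⊥ (g ∘ suc)
∑-singleton (suc j) g = ∑-singleton j (g ∘ suc)

∑-restricted-mono : ∀ {n} (R : Subset n) {f g : Fin n → ℕ} → (∀ u → u ∈ R → f u ≤ g u) →
                    ∑[ u < n ] (χ R u * f u) ≤ ∑[ u < n ] (χ R u * g u)
∑-restricted-mono R {f} {g} f≤g = ∑-mono-≤ pointwise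
  where
  pointwise : ∀ u → χ R u * f u ≤ χ R u * g u
  pointwise u with lookup R u in Ru
  ... | true  = +-monoˡ-≤ 0 (f≤g u (lookup⇒[]= u R Ru))
  ... | false = z≤n

∑-restricted-const : ∀ {n} (R : Subset n) x → ∑[ u < n ] (χ R u * x) ≡ ∣ R ∣ * x
∑-restricted-const R x = trans (sym (*-distribʳ-sum x (χ R))) (cong (_* x) (sym (∣∣-as-sum R)))

∣∪∣+∣∩∣ : ∀ {n} (p q : Subset n) → ∣ p ∪ q ∣ + ∣ p ∩ q ∣ ≡ ∣ p ∣ + ∣ q ∣
∣∪∣+∣∩∣ []            []            = refl
∣∪∣+∣∩∣ (inside  ∷ p) (inside  ∷ q) = cong suc (trans (+-suc _ _) (trans (cong suc (∣∪∣+∣∩∣ p q)) (sym (+-suc _ _))))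
∣∪∣+∣∩∣ (inside  ∷ p) (outside ∷ q) = cong suc (∣∪∣+∣∩∣ p q)
∣∪∣+∣∩∣ (outside ∷ p) (inside  ∷ q) = trans (cong suc (∣∪∣+∣∩∣ p q)) (sym (+-suc _ _))
∣∪∣+∣∩∣ (outside ∷ p) (outside ∷ q) = ∣∪∣+∣∩∣ p q

∣⊂∪∣-bound : ∀ {n} {N : Subset n} (X Y R : Subset n) → N ⊂ X ∪ (Y ∪ R) →
             suc ∣ N ∣ + ∣ X ∩ R ∣ + ∣ Y ∩ R ∣ ≤ ∣ X ∣ + ∣ Y ∣ + ∣ R ∣
∣⊂∪∣-bound {N = N} X Y R N⊂ = begin
  suc ∣ N ∣ + ∣ X ∩ R ∣ + ∣ Y ∩ R ∣
    ≤⟨ +-monoˡ-≤ ∣ Y ∩ R ∣ (+-mono-≤ (p⊂q⇒∣p∣<∣q∣ N⊂) (p⊆q⇒∣p∣≤∣q∣ X∩R⊆X∩[Y∪R])) ⟩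
  ∣ X ∪ (Y ∪ R) ∣ + ∣ X ∩ (Y ∪ R) ∣ + ∣ Y ∩ R ∣
    ≡⟨ cong (_+ ∣ Y ∩ R ∣) (∣∪∣+∣∩∣ X (Y ∪ R)) ⟩
  ∣ X ∣ + ∣ Y ∪ R ∣ + ∣ Y ∩ R ∣
    ≡⟨ +-assoc ∣ X ∣ _ _ ⟩
  ∣ X ∣ + (∣ Y ∪ R ∣ + ∣ Y ∩ R ∣)
    ≡⟨ cong (∣ X ∣ +_) (∣∪∣+∣∩∣ Y R) ⟩
  ∣ X ∣ + (∣ Y ∣ + ∣ R ∣)
    ≡⟨ +-assoc ∣ X ∣ _ _ ⟨
  ∣ X ∣ + ∣ Y ∣ + ∣ R ∣ ∎
  where
  open ≤-Reasoning
  X∩R⊆X∩[Y∪R] : X ∩ R ⊆ X ∩ (Y ∪ R)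
  X∩R⊆X∩[Y∪R] x∈ = x∈p∩q⁺ (p∩q⊆p X R x∈ , q⊆p∪q Y R (p∩q⊆q X R x∈))

⋃ᶠ : ∀ {m n} → (Fin m → Subset n) → Subset n
⋃ᶠ {zero}  F = ⊥
⋃ᶠ {suc m} F = F zero ∪ ⋃ᶠ (F ∘ suc)

∈⋃ᶠ⁻ : ∀ {m n} (F : Fin m → Subset n) {u} → u ∈ ⋃ᶠ F → ∃ λ i → u ∈ F i
∈⋃ᶠ⁻ {zero}  F u∈⋃F = contradiction u∈⋃F ∉⊥
∈⋃ᶠ⁻ {suc m} F u∈⋃F with x∈p∪q⁻ (F zero) (⋃ᶠ (F ∘ suc)) u∈⋃F
... | inj₁ u∈F₀ = zero , u∈F₀
... | inj₂ u∈⋃F′ with i , u∈Fi ← ∈⋃ᶠ⁻ (F ∘ suc) u∈⋃F′ = suc i , u∈Fi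

Disjoint : ∀ {m n} → (Fin m → Subset n) → Set
Disjoint F = ∀ {i j u} → u ∈ F i → u ∈ F j → i ≡ j

∣⋃ᶠ∣ : ∀ {m n} (F : Fin m → Subset n) → Disjoint F → ∣ ⋃ᶠ F ∣ ≡ ∑[ i < m ] ∣ F i ∣
∣⋃ᶠ∣ {zero}  {n} F disjoint = ∣⊥∣≡0 n
∣⋃ᶠ∣ {suc m} {n} F disjoint = begin
  ∣ F zero ∪ ⋃F′ ∣                          ≡⟨ +-identityʳ _ ⟨
  ∣ F zero ∪ ⋃F′ ∣ + 0                      ≡⟨ cong (∣ F zero ∪ ⋃F′ ∣ +_) head-meets-rest-trivially ⟨
  ∣ F zero ∪ ⋃F′ ∣ + ∣ F zero ∩ ⋃F′ ∣        ≡⟨ ∣∪∣+∣∩∣ (F zero) ⋃F′ ⟩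
  ∣ F zero ∣ + ∣ ⋃F′ ∣                      ≡⟨ cong (∣ F zero ∣ +_) (∣⋃ᶠ∣ (F ∘ suc) (λ u∈Fi u∈Fj → Fin-suc-injective (disjoint u∈Fi u∈Fj))) ⟩
  ∣ F zero ∣ + ∑[ i < m ] ∣ F (suc i) ∣     ∎
  where
  open ≡-Reasoning
  ⋃F′ : Subset n
  ⋃F′ = ⋃ᶠ (F ∘ suc)
  F₀∩⋃F′⊆⊥ : F zero ∩ ⋃F′ ⊆ ⊥
  F₀∩⋃F′⊆⊥ u∈ =
    let u∈F₀ , u∈⋃F′ = x∈p∩q⁻ (F zero) ⋃F′ u∈
        i , u∈Fi     = ∈⋃ᶠ⁻ (F ∘ suc) u∈⋃F′
    in  contradiction (disjoint u∈F₀ u∈Fi) λ ()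
  head-meets-rest-trivially : ∣ F zero ∩ ⋃F′ ∣ ≡ 0
  head-meets-rest-trivially = n≤0⇒n≡0 (≤-trans (p⊆q⇒∣p∣≤∣q∣ F₀∩⋃F′⊆⊥) (≤-reflexive (∣⊥∣≡0 n)))

module Partition {m n} (F : Fin m → Subset n) (disjoint : Disjoint F)
                 (total : ∑[ i < m ] ∣ F i ∣ ≡ n) where

  covers : ∀ u → ∃ λ i → u ∈ F i
  covers u = ∈⋃ᶠ⁻ F (subst (u ∈_) (sym ⋃F≡⊤) ∈⊤)
    where
    ⋃F≡⊤ : ⋃ᶠ F ≡ ⊤
    ⋃F≡⊤ = ∣p∣≡n⇒p≡⊤ (trans (∣⋃ᶠ∣ F disjoint) total)

  class : Fin n → Fin m
  class u = proj₁ (covers u)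

  ∈class : ∀ u → u ∈ F (class u)
  ∈class u = proj₂ (covers u)

  ∈⇔∈⁅class⁆ : ∀ u i → u ∈ F i ⇔ i ∈ ⁅ class u ⁆
  ∈⇔∈⁅class⁆ u i = mk⇔ (λ u∈Fi → subst (_∈ ⁅ class u ⁆) (disjoint (∈class u) u∈Fi) (x∈⁅x⁆ (class u)))
                     (λ i∈ → subst (λ j → u ∈ F j) (sym (x∈⁅y⁆⇒x≡y (class u) i∈)) (∈class u))

  ∑-over-classes : ∀ u (g : Fin m → ℕ) → ∑[ i < m ] (χ (F i) u * g i) ≡ g (class u)
  ∑-over-classes u g = trans (sum-cong-≗ (λ i → cong (_* g i) (χ-cong (∈⇔∈⁅class⁆ u i))))
                             (∑-singleton (class u) g)

  ∑-by-class : (R : Subset n) (g : Fin m → ℕ) →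
               ∑[ u < n ] (χ R u * g (class u)) ≡ ∑[ i < m ] (∣ F i ∩ R ∣ * g i)
  ∑-by-class R g = begin
    ∑[ u < n ] (χ R u * g (class u))                         ≡⟨ sum-cong-≗ (λ u → cong (χ R u *_) (∑-over-classes u g)) ⟨
    ∑[ u < n ] (χ R u * ∑[ i < m ] (χ (F i) u * g i))         ≡⟨ sum-cong-≗ (λ u → *-distribˡ-sum (χ R u) (λ i → χ (F i) u * g i)) ⟩
    ∑[ u < n ] ∑[ i < m ] (χ R u * (χ (F i) u * g i))         ≡⟨ ∑-comm (λ u i → χ R u * (χ (F i) u * g i)) ⟩
    ∑[ i < m ] ∑[ u < n ] (χ R u * (χ (F i) u * g i))         ≡⟨ sum-cong-≗ (λ i → sum-cong-≗ (λ u → rearrange (χ R u) (χ (F i) u) (g i))) ⟩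
    ∑[ i < m ] ∑[ u < n ] (χ (F i) u * χ R u * g i)           ≡⟨ sum-cong-≗ (λ i → *-distribʳ-sum (g i) (λ u → χ (F i) u * χ R u)) ⟨
    ∑[ i < m ] (∑[ u < n ] (χ (F i) u * χ R u) * g i)         ≡⟨ sum-cong-≗ (λ i → cong (_* g i) (∣∩∣-as-sum (F i) R)) ⟨
    ∑[ i < m ] (∣ F i ∩ R ∣ * g i)                            ∎
    where
    open ≡-Reasoning
    rearrange : ∀ x y z → x * (y * z) ≡ y * x * z
    rearrange = solve-∀

  ∑-∩≡∣∣ : (R : Subset n) → ∑[ i < m ] ∣ F i ∩ R ∣ ≡ ∣ R ∣
  ∑-∩≡∣∣ R = begin
    ∑[ i < m ] ∣ F i ∩ R ∣           ≡⟨ sum-cong-≗ (λ i → *-identityʳ ∣ F i ∩ R ∣) ⟨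
    ∑[ i < m ] (∣ F i ∩ R ∣ * 1)     ≡⟨ ∑-by-class R (λ _ → 1) ⟨
    ∑[ u < n ] (χ R u * 1)           ≡⟨ ∑-restricted-const R 1 ⟩
    ∣ R ∣ * 1                        ≡⟨ *-identityʳ ∣ R ∣ ⟩
    ∣ R ∣                            ∎
    where open ≡-Reasoning

  squares-bound : (R : Subset n) → ∣ R ∣ * ∣ R ∣ ≤ m * ∑[ i < m ] (∣ F i ∩ R ∣ * ∣ F i ∩ R ∣)
  squares-bound R = subst (λ r → r * r ≤ m * ∑[ i < m ] (∣ F i ∩ R ∣ * ∣ F i ∩ R ∣))
                          (∑-∩≡∣∣ R) (cauchy-schwarz (λ i → ∣ F i ∩ R ∣))

-- An inflationary operator f on subsets of Fin n is stationary after n + 1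
-- iterations: every non-stationary step strictly enlarges the set, and no subset
-- has more than n elements.
module Stabilisation {n} (f : Subset n → Subset n) (inflationary : ∀ X → X ⊆ f X) where

  -- f adds nothing to a closed set; closedness persists because then f X = X.
  Closed : Subset n → Set
  Closed X = f X ⊆ X

  closed-step : ∀ {X} → Closed X → Closed (f X)
  closed-step {X} fX⊆X = subst (λ Y → f Y ⊆ Y) (sym (⊆-antisym fX⊆X (inflationary X))) fX⊆X

  closed-or-grows : ∀ X → Closed X ⊎ ∣ X ∣ < ∣ f X ∣
  closed-or-grows X with X ⊂? f X
  ... | yes X⊂fX = inj₂ (p⊂q⇒∣p∣<∣q∣ X⊂fX)
  ... | no  X⊄fX = inj₁ fX⊆X
    where
    fX⊆X : f X ⊆ X
    fX⊆X {x} x∈fX with x ∈? X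
    ... | yes x∈X = x∈X
    ... | no  x∉X = contradiction ((λ {y} → inflationary X {y}) , x , x∈fX , x∉X) X⊄fX

  closed-or-large : ∀ X k → Closed (fold X f k) ⊎ k ≤ ∣ fold X f k ∣
  closed-or-large X zero = inj₂ z≤n
  closed-or-large X (suc k) with closed-or-large X k
  ... | inj₁ closed = inj₁ (closed-step closed)
  ... | inj₂ large with closed-or-grows (fold X f k)
  ...   | inj₁ closed = inj₁ (closed-step closed)
  ...   | inj₂ grows  = inj₂ (≤-trans (s≤s large) grows)

  stabilises : ∀ X → Closed (fold X f (suc n))
  stabilises X with closed-or-large X (suc n)
  ... | inj₁ closed    = closed
  ... | inj₂ too-large = contradiction (≤-trans too-large (∣p∣≤n (fold X f (suc n)))) (n≮n n)

⟦_⟧ : ∀ {n p} {P : Fin n → Set p} → (∀ u → Dec (P u)) → Subset n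
⟦ P? ⟧ = tabulate (does ∘ P?)

∈⟦⟧ : ∀ {n p} {P : Fin n → Set p} (P? : ∀ u → Dec (P u)) {u} → u ∈ ⟦ P? ⟧ ⇔ P u
∈⟦⟧ {P = P} P? {u} = mk⇔ sound complete
  where
  sound : u ∈ ⟦ P? ⟧ → P u
  sound u∈ with P? u | trans (sym (lookup∘tabulate (does ∘ P?) u)) ([]=⇒lookup u∈)
  ... | yes Pu | _ = Pu
  ... | no  _  | ()
  complete : P u → u ∈ ⟦ P? ⟧
  complete Pu = lookup⇒[]= u ⟦ P? ⟧ (trans (lookup∘tabulate (does ∘ P?) u) (dec-true (P? u) Pu))

module Reachability {n ℓ} {E : Fin n → Fin n → Set ℓ} (E? : ∀ u w → Dec (E u w)) where

  Successor : Subset n → Fin n → Set ℓ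
  Successor X w = ∃ λ u → u ∈ X × E u w

  successor? : ∀ X w → Dec (Successor X w)
  successor? X w = any? (λ u → u ∈? X ×-dec E? u w)

  successors : Subset n → Subset n
  successors X = ⟦ successor? X ⟧

  step : Subset n → Subset n
  step X = X ∪ successors X

  open Stabilisation step (λ X → p⊆p∪q (successors X))

  reach : Fin n → Subset n
  reach v = fold ⁅ v ⁆ step (suc n)

  -- The iterates contain v and only vertices reachable from v; the last one is
  -- stationary, hence closed under E and so contains everything reachable.
  iterates-reachable : ∀ v k {u} → u ∈ fold ⁅ v ⁆ step k → Star E v u
  iterates-reachable v zero    u∈ rewrite x∈⁅y⁆⇒x≡y v u∈ = ε
  iterates-reachable v (suc k) u∈ with x∈p∪q⁻ (fold ⁅ v ⁆ step k) _ u∈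
  ... | inj₁ u∈X = iterates-reachable v k u∈X
  ... | inj₂ u∈S with w , w∈X , e ← to (∈⟦⟧ (successor? _)) u∈S = iterates-reachable v k w∈X ◅◅ (e ◅ ε)

  v∈iterates : ∀ v k → v ∈ fold ⁅ v ⁆ step k
  v∈iterates v zero    = x∈⁅x⁆ v
  v∈iterates v (suc k) = p⊆p∪q _ (v∈iterates v k)

  reach-closed : ∀ {v u w} → u ∈ reach v → E u w → w ∈ reach v
  reach-closed {v} u∈ e = stabilises ⁅ v ⁆ (x∈p∪q⁺ (inj₂ (from (∈⟦⟧ (successor? _)) (_ , u∈ , e))))

  reach-along : ∀ {v x y} → x ∈ reach v → Star E x y → y ∈ reach v
  reach-along x∈ ε       = x∈
  reach-along x∈ (e ◅ p) = reach-along (reach-closed x∈ e) p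

  reach-spec : ∀ v u → u ∈ reach v ⇔ Star E v u
  reach-spec v u = mk⇔ (iterates-reachable v (suc n)) (reach-along (v∈iterates v (suc n)))

reachability-closed : ∀ {n ℓ} {E : Fin n → Fin n → Set ℓ} {S : Subset n} {v u w} →
                      (∀ x → x ∈ S ⇔ Star E v x) → u ∈ S → E u w → w ∈ S
reachability-closed S-spec u∈S e = from (S-spec _) (to (S-spec _) u∈S ◅◅ (e ◅ ε))

∈⇒∣∣>0 : ∀ {n} {p : Subset n} {u} → u ∈ p → 0 < ∣ p ∣
∈⇒∣∣>0 {p = p} {u} u∈p = ≤-trans (≤-reflexive (sym (∣⁅x⁆∣≡1 u))) (p⊆q⇒∣p∣≤∣q∣ ⁅u⁆⊆p)
  where
  ⁅u⁆⊆p : ⁅ u ⁆ ⊆ p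
  ⁅u⁆⊆p x∈⁅u⁆ = subst (_∈ p) (sym (x∈⁅y⁆⇒x≡y u x∈⁅u⁆)) u∈p

third-colour : ∀ (k₁ k₂ : Fin 3) → k₁ ≢ k₂ → ∃ λ k₃ → ∀ c → c ≡ k₁ ⊎ c ≡ k₂ ⊎ c ≡ k₃
third-colour 0F 1F _ = 2F , λ { 0F → inj₁ refl ; 1F → inj₂ (inj₁ refl) ; 2F → inj₂ (inj₂ refl) }
third-colour 0F 2F _ = 1F , λ { 0F → inj₁ refl ; 1F → inj₂ (inj₂ refl) ; 2F → inj₂ (inj₁ refl) }
third-colour 1F 0F _ = 2F , λ { 0F → inj₂ (inj₁ refl) ; 1F → inj₁ refl ; 2F → inj₂ (inj₂ refl) }
third-colour 1F 2F _ = 0F , λ { 0F → inj₂ (inj₂ refl) ; 1F → inj₁ refl ; 2F → inj₂ (inj₁ refl) }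
third-colour 2F 0F _ = 1F , λ { 0F → inj₂ (inj₁ refl) ; 1F → inj₂ (inj₂ refl) ; 2F → inj₁ refl }
third-colour 2F 1F _ = 0F , λ { 0F → inj₂ (inj₂ refl) ; 1F → inj₂ (inj₁ refl) ; 2F → inj₁ refl }
third-colour 0F 0F k₁≢k₂ = contradiction refl k₁≢k₂
third-colour 1F 1F k₁≢k₂ = contradiction refl k₁≢k₂
third-colour 2F 2F k₁≢k₂ = contradiction refl k₁≢k₂

δ≤deg : ∀ {n} (G : Coloured3Graph n) u → δ G ≤ deg G u
δ≤deg {n} G = minOver≤ n (deg G)
  where
  minOver≤ : ∀ n (f : Fin n → ℕ) i → minOver n f ≤ f i
  minOver≤ 1                 f 0F      = ≤-refl
  minOver≤ (suc (suc n)) f 0F      = m⊓n≤m _ _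
  minOver≤ (suc (suc n)) f (suc i) = ≤-trans (m⊓n≤n _ _) (minOver≤ (suc n) (f ∘ suc) i)

module _ {n} (G : Coloured3Graph n) where

  Adj? : ∀ k u w → Dec (Adj G k u w)
  Adj? k u w = ≡-dec Fin._≟_ (col G u w) (just k)

  nbhd-colour : ∀ {u w} → w ∈ nbhd G u → ∃ λ k → Adj G k u w
  nbhd-colour {u} {w} w∈N with col G u w | trans (sym (lookup∘tabulate (is-just ∘ col G u) w)) ([]=⇒lookup w∈N)
  ... | just k  | _  = k , refl
  ... | nothing | ()

  u∉nbhd : ∀ u → u ∉ nbhd G u
  u∉nbhd u u∈N with trans (sym (lookup∘tabulate (is-just ∘ col G u) u)) ([]=⇒lookup u∈N)
  ... | u∈N′ rewrite irrefl G u with () ← u∈N′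

  component-closed : ∀ {k S u w} → Component G k S → u ∈ S → Adj G k u w → w ∈ S
  component-closed (_ , _ , S-spec) = reachability-closed S-spec

  components-meet : ∀ {k S T u} → Component G k S → Component G k T → u ∈ S → u ∈ T → S ≡ T
  components-meet S-comp T-comp u∈S u∈T = ⊆-antisym (absorbed S-comp T-comp u∈S u∈T) (absorbed T-comp S-comp u∈T u∈S)
    where
    adj-sym : ∀ {k u w} → Adj G k u w → Adj G k w u
    adj-sym {u = u} {w} uw = trans (Coloured3Graph.sym G w u) uw
    absorbed : ∀ {k S T u} → Component G k S → Component G k T → u ∈ S → u ∈ T → S ⊆ T
    absorbed (v , _ , S-spec) (v′ , _ , T-spec) u∈S u∈T x∈S =
      from (T-spec _) (to (T-spec _) u∈T ◅◅ reverse adj-sym (to (S-spec _) u∈S) ◅◅ to (S-spec _) x∈S)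

  component-nonempty : ∀ {k S} → Component G k S → 0 < ∣ S ∣
  component-nonempty (v , _ , S-spec) = ∈⇒∣∣>0 (from (S-spec v) ε)

  mono-reach : Fin 3 → Fin n → Subset n
  mono-reach k = Reachability.reach (Adj? k)

  v∈mono-reach : ∀ k v → v ∈ mono-reach k v
  v∈mono-reach k v = from (Reachability.reach-spec (Adj? k) v v) ε

  mono-reach-closed : ∀ {k v u w} → u ∈ mono-reach k v → Adj G k u w → w ∈ mono-reach k v
  mono-reach-closed {k} {v} = reachability-closed (Reachability.reach-spec (Adj? k) v)

  -- If all monochromatic components have fewer than n/2 vertices and n ≥ 2, every
  -- mono-reach set has at most n/2 vertices: it is a component when v has an edge
  -- of colour k, and {v} otherwise.
  mono-reach-small : (∀ k S → Component G k S → 2 * ∣ S ∣ < n) → 2 ≤ n →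
                     ∀ k v → 2 * ∣ mono-reach k v ∣ ≤ n
  mono-reach-small small 2≤n k v with any? (Adj? k v)
  ... | yes incident = <⇒≤ (small k _ (v , incident , Reachability.reach-spec (Adj? k) v))
  ... | no  isolated = ≤-trans (*-monoʳ-≤ 2 (≤-trans (p⊆q⇒∣p∣≤∣q∣ ⊆⁅v⁆) (≤-reflexive (∣⁅x⁆∣≡1 v)))) 2≤n
    where
    ⊆⁅v⁆ : mono-reach k v ⊆ ⁅ v ⁆
    ⊆⁅v⁆ u∈ with to (Reachability.reach-spec (Adj? k) v _) u∈
    ... | ε     = x∈⁅x⁆ v
    ... | e ◅ _ = contradiction (_ , e) isolated

module ComponentPartition {n m} (G : Coloured3Graph n) (k : Fin 3) (F : Fin m → Subset n)
         (distinct : Injective _≡_ _≡_ F) (component : ∀ i → Component G k (F i))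
         {a} (order : ∀ i → ∣ F i ∣ ≡ a) (total : m * a ≡ n) where

  disjoint : Disjoint F
  disjoint u∈Fi u∈Fj = distinct (components-meet G (component _) (component _) u∈Fi u∈Fj)

  open Partition F disjoint (trans (trans (sum-cong-≗ order) (∑-const m a)) total) public

  class-closed : ∀ {u w} → Adj G k u w → w ∈ F (class u)
  class-closed = component-closed G (component _) (∈class _)

module DegreeCount {n m} (G : Coloured3Graph n) {k₁ k₂ k₃ : Fin 3}
         (colours : ∀ c → c ≡ k₁ ⊎ c ≡ k₂ ⊎ c ≡ k₃)
         (A B : Fin m → Subset n) (distinctA : Injective _≡_ _≡_ A) (distinctB : Injective _≡_ _≡_ B)
         (componentA : ∀ i → Component G k₁ (A i)) (componentB : ∀ i → Component G k₂ (B i))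
         {a} (orderA : ∀ i → ∣ A i ∣ ≡ a) (orderB : ∀ i → ∣ B i ∣ ≡ a) (total : m * a ≡ n)
         (R : Subset n) (R-closed : ∀ {u w} → u ∈ R → Adj G k₃ u w → w ∈ R) where

  module 𝒜 = ComponentPartition G k₁ A distinctA componentA orderA total
  module ℬ = ComponentPartition G k₂ B distinctB componentB orderB total

  cA cB : Fin m → ℕ
  cA i = ∣ A i ∩ R ∣
  cB i = ∣ B i ∩ R ∣

  vertex-bound : ∀ {u} → u ∈ R → suc (deg G u) + cA (𝒜.class u) + cB (ℬ.class u) ≤ a + a + ∣ R ∣
  vertex-bound {u} u∈R = subst (λ x → suc (deg G u) + cA (𝒜.class u) + cB (ℬ.class u) ≤ x + ∣ R ∣) (cong₂ _+_ (orderA _) (orderB _))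
                           (∣⊂∪∣-bound (A (𝒜.class u)) (B (ℬ.class u)) R N⊂)
    where
    placed : ∀ {w} c → Adj G c u w → w ∈ A (𝒜.class u) ∪ (B (ℬ.class u) ∪ R)
    placed c uw with colours c
    ... | inj₁ refl        = x∈p∪q⁺ (inj₁ (𝒜.class-closed uw))
    ... | inj₂ (inj₁ refl) = x∈p∪q⁺ (inj₂ (x∈p∪q⁺ (inj₁ (ℬ.class-closed uw))))
    ... | inj₂ (inj₂ refl) = x∈p∪q⁺ (inj₂ (x∈p∪q⁺ (inj₂ (R-closed u∈R uw))))
    N⊂ : nbhd G u ⊂ A (𝒜.class u) ∪ (B (ℬ.class u) ∪ R)
    N⊂ = (λ w∈N → placed _ (proj₂ (nbhd-colour G w∈N))) , u , x∈p∪q⁺ (inj₁ (𝒜.∈class u)) , u∉nbhd G u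

  degree-sum : ∣ R ∣ * suc (δ G) + ∑[ i < m ] (cA i * cA i) + ∑[ i < m ] (cB i * cB i) ≤ ∣ R ∣ * (a + a + ∣ R ∣)
  degree-sum = begin
    ∣ R ∣ * suc (δ G) + ∑[ i < m ] (cA i * cA i) + ∑[ i < m ] (cB i * cB i)
      ≡⟨ cong₂ _+_ (cong₂ _+_ (∑-restricted-const R (suc (δ G))) (𝒜.∑-by-class R cA)) (ℬ.∑-by-class R cB) ⟨
    ∑[ u < n ] (χ R u * suc (δ G)) + ∑[ u < n ] (χ R u * cA (𝒜.class u)) + ∑[ u < n ] (χ R u * cB (ℬ.class u))
      ≡⟨ trans (∑-distrib-+ (λ u → fδ u + fA u) fB) (cong (_+ sum fB) (∑-distrib-+ fδ fA)) ⟨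
    ∑[ u < n ] (χ R u * suc (δ G) + χ R u * cA (𝒜.class u) + χ R u * cB (ℬ.class u))
      ≡⟨ sum-cong-≗ (λ u → distrib (χ R u) (suc (δ G)) _ _) ⟩
    ∑[ u < n ] (χ R u * (suc (δ G) + cA (𝒜.class u) + cB (ℬ.class u)))
      ≤⟨ ∑-restricted-mono R (λ u u∈R → ≤-trans (+-monoˡ-≤ _ (+-monoˡ-≤ _ (s≤s (δ≤deg G u)))) (vertex-bound u∈R)) ⟩
    ∑[ u < n ] (χ R u * (a + a + ∣ R ∣))
      ≡⟨ ∑-restricted-const R (a + a + ∣ R ∣) ⟩
    ∣ R ∣ * (a + a + ∣ R ∣) ∎
    where
    open ≤-Reasoning
    distrib : ∀ x y z w → x * y + x * z + x * w ≡ x * (y + z + w)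
    distrib = solve-∀
    fδ fA fB : Fin n → ℕ
    fδ u = χ R u * suc (δ G)
    fA u = χ R u * cA (𝒜.class u)
    fB u = χ R u * cB (ℬ.class u)

averaged-degree-bound : ∀ {d r a SA SB} → r * suc d + SA + SB ≤ r * (a + a + r) →
                        r * r ≤ 4 * SA → r * r ≤ 4 * SB → 0 < r → 2 * suc d ≤ 4 * a + r
averaged-degree-bound {d} {r} {a} {SA} {SB} summed r²≤4SA r²≤4SB r>0 =
  *-cancelˡ-≤ 2 (+-cancelʳ-≤ (2 * r) _ _ (*-cancelˡ-≤ r ⦃ >-nonZero r>0 ⦄ (begin
    r * (2 * (2 * suc d) + 2 * r)             ≡⟨ expand d r ⟩
    4 * (r * suc d) + (r * r + r * r)         ≤⟨ +-monoʳ-≤ (4 * (r * suc d)) (+-mono-≤ r²≤4SA r²≤4SB) ⟩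
    4 * (r * suc d) + (4 * SA + 4 * SB)       ≡⟨ collect (r * suc d) SA SB ⟩
    4 * (r * suc d + SA + SB)                 ≤⟨ *-monoʳ-≤ 4 summed ⟩
    4 * (r * (a + a + r))                     ≡⟨ regroup r a ⟩
    r * (2 * (4 * a + r) + 2 * r)             ∎)))
  where
  open ≤-Reasoning
  expand : ∀ d r → r * (2 * (2 * suc d) + 2 * r) ≡ 4 * (r * suc d) + (r * r + r * r)
  expand = solve-∀
  collect : ∀ x y z → 4 * x + (4 * y + 4 * z) ≡ 4 * (x + y + z)
  collect = solve-∀
  regroup : ∀ r a → 4 * (r * (a + a + r)) ≡ r * (2 * (4 * a + r) + 2 * r)
  regroup = solve-∀

final-arithmetic : ∀ {d r a} → 2 * suc d ≤ 4 * a + r → 2 * r ≤ 4 * a → 6 * d < 5 * (4 * a)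
final-arithmetic {d} {r} {a} averaged 2r≤4a = *-cancelˡ-< 2 (6 * d) (5 * (4 * a)) (begin-strict
  2 * (6 * d)                 <⟨ m<m+n (2 * (6 * d)) {12} z<s ⟩
  2 * (6 * d) + 12            ≡⟨ twelve d ⟩
  6 * (2 * suc d)             ≤⟨ *-monoʳ-≤ 6 averaged ⟩
  6 * (4 * a + r)             ≡⟨ split a r ⟩
  24 * a + 3 * (2 * r)        ≤⟨ +-monoʳ-≤ (24 * a) (*-monoʳ-≤ 3 2r≤4a) ⟩
  24 * a + 3 * (4 * a)        ≤⟨ ≤-trans (≤-reflexive (collect a)) (m≤m+n (36 * a) (4 * a)) ⟩
  36 * a + 4 * a              ≡⟨ total a ⟩
  2 * (5 * (4 * a))           ∎)
  where
  open ≤-Reasoning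
  twelve : ∀ d → 2 * (6 * d) + 12 ≡ 6 * (2 * suc d)
  twelve = solve-∀
  split : ∀ a r → 6 * (4 * a + r) ≡ 24 * a + 3 * (2 * r)
  split = solve-∀
  collect : ∀ a → 24 * a + 3 * (4 * a) ≡ 36 * a
  collect = solve-∀
  total : ∀ a → 36 * a + 4 * a ≡ 2 * (5 * (4 * a))
  total = solve-∀

lemma3p5 : (n : ℕ) (G : Coloured3Graph n) →
    (∀ (k : Fin 3) (S : Subset n) → Component G k S → 2 * ∣ S ∣ < n) →
    (k₁ k₂ : Fin 3) → ¬ (k₁ ≡ k₂) →
    (Σ (Fin 4 → Subset n) λ C → Injective _≡_ _≡_ C ×
       (∀ i → Component G k₁ (C i) × 4 * ∣ C i ∣ ≡ n)) →
    (Σ (Fin 4 → Subset n) λ C → Injective _≡_ _≡_ C ×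
       (∀ i → Component G k₂ (C i) × 4 * ∣ C i ∣ ≡ n)) →
    6 * δ G < 5 * n
lemma3p5 n G small k₁ k₂ k₁≢k₂ (A , distinctA , A-spec) (B , distinctB , B-spec) =
  subst (λ x → 6 * δ G < 5 * x) 4a≡n (final-arithmetic {a = a} averaged R-small)
  where
  a : ℕ
  a = ∣ A 0F ∣
  4a≡n : 4 * a ≡ n
  4a≡n = proj₂ (A-spec 0F)
  order : ∀ C → 4 * ∣ C ∣ ≡ n → ∣ C ∣ ≡ a
  order C 4c≡n = *-cancelˡ-≡ ∣ C ∣ a 4 (trans 4c≡n (sym 4a≡n))
  k₃ : Fin 3
  k₃ = proj₁ (third-colour k₁ k₂ k₁≢k₂)
  v : Fin n
  v = proj₁ (proj₁ (A-spec 0F))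
  R : Subset n
  R = mono-reach G k₃ v
  open DegreeCount G (proj₂ (third-colour k₁ k₂ k₁≢k₂)) A B distinctA distinctB
         (proj₁ ∘ A-spec) (proj₁ ∘ B-spec) (λ i → order (A i) (proj₂ (A-spec i)))
         (λ i → order (B i) (proj₂ (B-spec i))) 4a≡n R (mono-reach-closed G)
  averaged : 2 * suc (δ G) ≤ 4 * a + ∣ R ∣
  averaged = averaged-degree-bound {a = a} degree-sum (𝒜.squares-bound R) (ℬ.squares-bound R)
                                   (∈⇒∣∣>0 (v∈mono-reach G k₃ v))
  -- n ≥ 2 because the component A₀ is nonempty.
  R-small : 2 * ∣ R ∣ ≤ 4 * a
  R-small = subst (2 * ∣ R ∣ ≤_) (sym 4a≡n) (mono-reach-small G small 2≤n k₃ v)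
    where
    2≤n : 2 ≤ n
    2≤n = subst (2 ≤_) 4a≡n (≤-trans (s≤s (s≤s z≤n)) (*-monoʳ-≤ 4 (component-nonempty G (proj₁ (A-spec 0F)))))
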